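{- Let $G=(A\cup B,E)$ be a marriage instance with critical set $C\subseteq A$, and let $M$ be a popular feasible matching of $G$. After the leveling procedure described in the context is applied to $M$, every non-critical man (man in $A\setminus C$) is assigned level $0$ or $1$.
   Context: A marriage instance is a bipartite graph $G=(A\cup B,E)$ ($A$ men, $B$ women) with strict preference lists; every vertex prefers being matched to any neighbour over being unmatched. For matchings $M,N$, $\phi(N,M)$ is the number of vertices preferring $N$ to $M$ (matched in $N$ but not in $M$, or matched in both and preferring the $N$-partner). A matching is feasible if it matches all of $C$; a popular feasible matching is a feasible $M$ with $\phi(N,M)\le\phi(M,N)$ for all feasible $N$. Edge labels: given $M$, for an edge $(u,v)\notin M$, $u$ gives label $+1$ if $u$ prefers $v$ to $M(u)$ and $-1$ otherwise; similarly for $v$. The edge's label is written (label from the man, label from the woman). Leveling procedure (Algorithm 1) applied to $M$: initially every vertex has level $0$. Repeat the following three phases until none of them changes any level: Phase 1: while there is an edge $(m,w)$ labelled $(+1,+1)$ with level$(w)\le$ level$(m)=i$, set level$(w)$=level$(M(w))=i+1$. Phase 2: while there is an edge $(m,w)$ labelled $(+1,-1)$ or $(-1,+1)$ with level$(w)<$ level$(m)=i$, set level$(w)$=level$(M(w))=i$. Phase 3: while there is an edge $(m,w)$ labelled $(-1,-1)$ with level$(w)\le$ level$(m)-2$, where level$(m)=i$, set level$(w)$=level$(M(w))=i-1$. -}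

module Defs where

open import Data.Nat using (ℕ; zero; suc; _+_; _≤_; _<_; _∸_; _<ᵇ_)
open import Data.Fin using (Fin; zero; suc; _≟_)
open import Data.Bool using (Bool; true; false; if_then_else_; _xor_; _∧_; not)
open import Data.Maybe using (Maybe; just; nothing)
open import Data.Product using (Σ; _×_; _,_; ∃; ∃-syntax; proj₁; proj₂)
open import Relation.Nullary using (¬_; does)
open import Relation.Binary.PropositionalEquality using (_≡_)
open import Relation.Binary.Construct.Closure.ReflexiveTransitive using (Star)

count : ∀ {n} → (Fin n → Bool) → ℕ
count {zero}  p = 0
count {suc n} p = (if p zero then 1 else 0) + count (λ i → p (suc i))

-- A marriage instance G = (A ∪ B, E) with A = Fin nA (men), B = Fin nB (women),
-- strict preference lists given by ranks (smaller rank = more preferred),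
-- required to be injective on the neighbourhood of each vertex,
-- and a critical set C ⊆ A.
record Instance : Set where
  field
    nA nB   : ℕ
    E       : Fin nA → Fin nB → Bool
    rankA   : Fin nA → Fin nB → ℕ
    rankB   : Fin nB → Fin nA → ℕ
    rankA-strict : ∀ m w w′ → E m w ≡ true → E m w′ ≡ true →
                   rankA m w ≡ rankA m w′ → w ≡ w′
    rankB-strict : ∀ w m m′ → E m w ≡ true → E m′ w ≡ true →
                   rankB w m ≡ rankB w m′ → m ≡ m′
    C       : Fin nA → Bool

module _ (G : Instance) where
  open Instance G

  prefA : Fin nA → Maybe (Fin nB) → Maybe (Fin nB) → Bool
  prefA m (just w) nothing   = true
  prefA m (just w) (just w′) = rankA m w <ᵇ rankA m w′
  prefA m nothing  _         = false

  prefB : Fin nB → Maybe (Fin nA) → Maybe (Fin nA) → Bool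
  prefB w (just m) nothing   = true
  prefB w (just m) (just m′) = rankB w m <ᵇ rankB w m′
  prefB w nothing  _         = false

  record Matching : Set where
    field
      pA : Fin nA → Maybe (Fin nB)
      pB : Fin nB → Maybe (Fin nA)
      pA⇒pB : ∀ m w → pA m ≡ just w → pB w ≡ just m
      pB⇒pA : ∀ m w → pB w ≡ just m → pA m ≡ just w
      inE   : ∀ m w → pA m ≡ just w → E m w ≡ true

  open Matching

  φ : Matching → Matching → ℕ
  φ N M = count (λ m → prefA m (pA N m) (pA M m))
        + count (λ w → prefB w (pB N w) (pB M w))

  Feasible : Matching → Set
  Feasible M = ∀ m → C m ≡ true → ∃[ w ] pA M m ≡ just w

  PopularFeasible : Matching → Set
  PopularFeasible M = Feasible M × (∀ N → Feasible N → φ N M ≤ φ M N)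

  module Leveling (M : Matching) where

    -- labels (true = +1, false = -1) of an edge (m,w) ∉ M
    labA : Fin nA → Fin nB → Bool
    labA m w = prefA m (just w) (pA M m)

    labB : Fin nA → Fin nB → Bool
    labB m w = prefB w (just m) (pB M w)

    NonMatchingEdge : Fin nA → Fin nB → Set
    NonMatchingEdge m w = (E m w ≡ true) × ¬ (pA M m ≡ just w)

    Levels : Set
    Levels = (Fin nA → ℕ) × (Fin nB → ℕ)

    initial : Levels
    initial = (λ _ → 0) , (λ _ → 0)

    setW : Levels → Fin nB → ℕ → Levels
    setW (la , lb) w k =
      (λ m → upd m (pB M w)) , (λ w′ → if does (w′ ≟ w) then k else lb w′)
      where
      upd : Fin nA → Maybe (Fin nA) → ℕ
      upd m (just m′) = if does (m ≟ m′) then k else la m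
      upd m nothing   = la m

    Cond1 : Levels → Fin nA → Fin nB → Set
    Cond1 L m w = NonMatchingEdge m w × labA m w ≡ true × labB m w ≡ true
                × proj₂ L w ≤ proj₁ L m

    data Step1 : Levels → Levels → Set where
      step1 : ∀ L m w → Cond1 L m w → Step1 L (setW L w (suc (proj₁ L m)))

    Cond2 : Levels → Fin nA → Fin nB → Set
    Cond2 L m w = NonMatchingEdge m w × (labA m w xor labB m w) ≡ true
                × proj₂ L w < proj₁ L m

    data Step2 : Levels → Levels → Set where
      step2 : ∀ L m w → Cond2 L m w → Step2 L (setW L w (proj₁ L m))

    Cond3 : Levels → Fin nA → Fin nB → Set
    Cond3 L m w = NonMatchingEdge m w × labA m w ≡ false × labB m w ≡ false
                × proj₂ L w + 2 ≤ proj₁ L m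

    data Step3 : Levels → Levels → Set where
      step3 : ∀ L m w → Cond3 L m w → Step3 L (setW L w (proj₁ L m ∸ 1))

    Enabled : (Levels → Fin nA → Fin nB → Set) → Levels → Set
    Enabled Cond L = ∃[ m ] ∃[ w ] Cond L m w

    Phase : (Levels → Levels → Set) → (Levels → Fin nA → Fin nB → Set) →
            Levels → Levels → Set
    Phase Step Cond L L′ = Star Step L L′ × ¬ Enabled Cond L′

    Round : Levels → Levels → Set
    Round L L′ = ∃[ L₁ ] ∃[ L₂ ] Phase Step1 Cond1 L L₁ × Phase Step2 Cond2 L₁ L₂
               × Phase Step3 Cond3 L₂ L′

    -- L is a possible output of the leveling procedure applied to M:
    -- reached from the all-zero levels by iterations, and a further
    -- iteration changes no level (no phase can fire).
    Result : Levels → Set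
    Result L = Star Round initial L
             × ¬ Enabled Cond1 L × ¬ Enabled Cond2 L × ¬ Enabled Cond3 L

-- Every man m of level ℓ starts a simple M-alternating walk m, M(m), m₁, M(m₁), …
-- whose weight, the sum of both labels of its non-matching edges, is at least 2ℓ.
-- A step giving w a level along (m, w) prepends M(w) and the edge (m, w) to the walk
-- of m; if M(w) already lies on that walk, the part before it closes an alternating
-- cycle, which popularity forces to have weight ≤ 0, so the suffix from M(w) does at
-- least as well.  Switching M along a walk changes φ(N, M) − φ(M, N) by its weight
-- minus the number of vertices left unmatched; for a simple walk from a non-critical
-- man these are at most the man himself and the partner of the last man, the switched
-- matching stays feasible, and popularity gives weight ≤ 2, i.e. level ≤ 1.
module Submission where

open import Defs
open import Data.Bool using (Bool; true; false; if_then_else_; _∧_; _xor_)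
open import Data.Empty using (⊥-elim)
open import Data.Fin using (Fin; zero; suc; _≟_)
open import Data.Fin.Properties using (suc-injective)
open import Data.Integer as ℤ using (ℤ; +_; -[1+_]; -_; 0ℤ; -1ℤ; _+_; _-_; _≤_)
import Data.Integer.Properties as ℤ
open import Algebra.Properties.CommutativeMonoid.Sum ℤ.+-0-commutativeMonoid
  using (sum; sum-cong-≗; sum-replicate-zero; ∑-distrib-+)
open import Data.Integer.Tactic.RingSolver using (solve-∀)
open import Data.List using (List; []; _∷_)
import Data.List.Membership.DecPropositional as DecMembership
open import Data.List.Membership.Propositional using (_∈_; _∉_)
open import Data.List.Relation.Unary.Any using (here; there)
open import Data.Maybe using (Maybe; just; nothing; _<∣>_; _>>=_; maybe; is-just; is-nothing)
open import Data.Maybe.Properties using (just-injective)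
open import Data.Nat as ℕ using (zero; suc; _<ᵇ_; _∸_; s≤s)
import Data.Nat.Properties as ℕ
open import Data.Product using (Σ; _×_; _,_; proj₁; proj₂; ∃-syntax; ∃₂)
open import Data.Sum using (_⊎_; inj₁; inj₂)
open import Data.Unit using (⊤; tt)
open import Function using (_∘_; id)
open import Relation.Binary.Construct.Closure.ReflexiveTransitive using (Star; fold)
open import Relation.Binary.PropositionalEquality
open import Relation.Nullary using (does; yes; no)
open import Relation.Nullary.Decidable using (dec-true)

indicator : Bool → ℤ
indicator true  = + 1
indicator false = 0ℤ

sign : Bool → ℤ
sign true  = + 1
sign false = -1ℤ

count-as-sum : ∀ {n} (p : Fin n → Bool) → + count p ≡ sum (λ i → indicator (p i))
count-as-sum {zero}  p = refl
count-as-sum {suc n} p =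
  trans (ℤ.pos-+ (if p zero then 1 else 0) _)
        (cong₂ _+_ (head-term (p zero)) (count-as-sum (λ i → p (suc i))))
  where
  head-term : ∀ b → + (if b then 1 else 0) ≡ indicator b
  head-term true  = refl
  head-term false = refl

sum-zero : ∀ {n} (f : Fin n → ℤ) → (∀ i → f i ≡ 0ℤ) → sum f ≡ 0ℤ
sum-zero {n} f f≡0 = trans (sum-cong-≗ f≡0) (sum-replicate-zero n)

sum-δ : ∀ {n} (j : Fin n) (a : ℤ) → sum (λ i → if does (i ≟ j) then a else 0ℤ) ≡ a
sum-δ {suc n} zero    a = trans (cong (λ s → a + s) (sum-zero {n} _ (λ _ → refl))) (ℤ.+-identityʳ a)
sum-δ {suc n} (suc j) a = trans (ℤ.+-identityˡ _) (sum-δ j a)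

sum-insert : ∀ {n} (j : Fin n) (a : ℤ) (f g : Fin n → ℤ) → f j ≡ 0ℤ →
             (∀ i → g i ≡ (if does (i ≟ j) then a else f i)) → sum g ≡ a + sum f
sum-insert j a f g fj≡0 g≗ = begin
  sum g                                                     ≡⟨ sum-cong-≗ split ⟩
  sum (λ i → (if does (i ≟ j) then a else 0ℤ) + f i)        ≡⟨ ∑-distrib-+ _ f ⟩
  sum (λ i → if does (i ≟ j) then a else 0ℤ) + sum f        ≡⟨ cong (_+ sum f) (sum-δ j a) ⟩
  a + sum f                                                 ∎
  where
  open ≡-Reasoning
  split : ∀ i → g i ≡ (if does (i ≟ j) then a else 0ℤ) + f i
  split i rewrite g≗ i with i ≟ j
  ... | yes refl = trans (sym (ℤ.+-identityʳ a)) (cong (λ s → a + s) (sym fj≡0))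
  ... | no _     = sym (ℤ.+-identityˡ (f i))

sum-≥-1 : ∀ {n} (f : Fin n → ℤ) → (∀ i → f i ≡ 0ℤ ⊎ f i ≡ -1ℤ) →
          (∀ i j → f i ≡ -1ℤ → f j ≡ -1ℤ → i ≡ j) → -1ℤ ≤ sum f
sum-≥-1 {zero}  f values unique = ℤ.-≤+
sum-≥-1 {suc n} f values unique with values zero
... | inj₁ f₀≡0 rewrite f₀≡0 | ℤ.+-identityˡ (sum (λ i → f (suc i))) =
  sum-≥-1 (λ i → f (suc i)) (λ i → values (suc i))
          (λ i j fi fj → suc-injective (unique (suc i) (suc j) fi fj))
... | inj₂ f₀≡-1 = ℤ.≤-reflexive (sym (cong₂ _+_ f₀≡-1 (sum-zero _ rest≡0)))
  where
  rest≡0 : ∀ i → f (suc i) ≡ 0ℤ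
  rest≡0 i with values (suc i)
  ... | inj₁ e = e
  ... | inj₂ e with unique zero (suc i) f₀≡-1 e
  ... | ()

neg-indicator-values : ∀ b → - indicator b ≡ 0ℤ ⊎ - indicator b ≡ -1ℤ
neg-indicator-values true  = inj₂ refl
neg-indicator-values false = inj₁ refl

indicator-<ᵇ-flip : ∀ r s → r ≢ s → indicator (r <ᵇ s) ≡ indicator (s <ᵇ r) + sign (r <ᵇ s)
indicator-<ᵇ-flip zero    zero    r≢s = ⊥-elim (r≢s refl)
indicator-<ᵇ-flip zero    (suc s) _   = refl
indicator-<ᵇ-flip (suc r) zero    _   = refl
indicator-<ᵇ-flip (suc r) (suc s) r≢s = indicator-<ᵇ-flip r s (r≢s ∘ cong suc)

unlessCovered : {A B : Set} → Maybe A → B → Maybe B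
unlessCovered (just _) _ = nothing
unlessCovered nothing  b = just b

module Exchanges (G : Instance) (M : Matching G) where
  open Instance G
  open Leveling G M
  open Matching M

  prefA-flip : ∀ m w (cur : Maybe (Fin nB)) → E m w ≡ true → (∀ v → cur ≡ just v → E m v ≡ true) →
              cur ≢ just w → indicator (prefA G m (just w) cur)
                           ≡ indicator (prefA G m cur (just w)) + sign (prefA G m (just w) cur)
  prefA-flip m w nothing  _  _  _   = refl
  prefA-flip m w (just v) mw mv v≢w =
    indicator-<ᵇ-flip _ _ (λ r → v≢w (cong just (sym (rankA-strict m w v mw (mv v refl) r))))

  prefB-flip : ∀ w m (cur : Maybe (Fin nA)) → E m w ≡ true → (∀ u → cur ≡ just u → E u w ≡ true) →
              cur ≢ just m → indicator (prefB G w (just m) cur)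
                           ≡ indicator (prefB G w cur (just m)) + sign (prefB G w (just m) cur)
  prefB-flip w m nothing  _  _  _   = refl
  prefB-flip w m (just u) mw uw u≢m =
    indicator-<ᵇ-flip _ _ (λ r → u≢m (cong just (sym (rankB-strict w m u mw (uw u refl) r))))

  φ-as-sum : ∀ N N′ → + φ G N N′ ≡ sum (λ m → indicator (prefA G m (Matching.pA N m) (Matching.pA N′ m)))
                                 + sum (λ w → indicator (prefB G w (Matching.pB N w) (Matching.pB N′ w)))
  φ-as-sum N N′ = trans (ℤ.pos-+ (count votesA) (count votesB))
                        (cong₂ _+_ (count-as-sum votesA) (count-as-sum votesB))
    where
    votesA : Fin nA → Bool
    votesA m = prefA G m (Matching.pA N m) (Matching.pA N′ m)
    votesB : Fin nB → Bool
    votesB w = prefB G w (Matching.pB N w) (Matching.pB N′ w)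

  record Exchange : Set where
    field
      sA : Fin nA → Maybe (Fin nB)
      sB : Fin nB → Maybe (Fin nA)
      sA⇒sB : ∀ m w → sA m ≡ just w → sB w ≡ just m
      sB⇒sA : ∀ m w → sB w ≡ just m → sA m ≡ just w
      nonMatching : ∀ m w → sA m ≡ just w → NonMatchingEdge m w

  module _ (S : Exchange) where
    open Exchange S

    newA : Fin nA → Maybe (Fin nB)
    newA m = sA m <∣> (pA m >>= λ w → unlessCovered (sB w) w)

    newB : Fin nB → Maybe (Fin nA)
    newB w = sB w <∣> (pB w >>= λ m → unlessCovered (sA m) m)

    private
      newA⇒newB : ∀ m w → newA m ≡ just w → newB w ≡ just m
      newA⇒newB m w eq with sA m in s
      ... | just _ with refl ← eq rewrite sA⇒sB m w s = refl
      newA⇒newB m w eq | nothing with pA m in p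
      ... | just v with sB v in c
      ... | nothing with refl ← eq rewrite c | pA⇒pB m v p | s = refl

      newB⇒newA : ∀ m w → newB w ≡ just m → newA m ≡ just w
      newB⇒newA m w eq with sB w in s
      ... | just _ with refl ← eq rewrite sB⇒sA m w s = refl
      newB⇒newA m w eq | nothing with pB w in p
      ... | just u with sA u in c
      ... | nothing with refl ← eq rewrite c | pB⇒pA m w p | s = refl

      newA-inE : ∀ m w → newA m ≡ just w → E m w ≡ true
      newA-inE m w eq with sA m in s
      ... | just _ with refl ← eq = proj₁ (nonMatching m w s)
      newA-inE m w eq | nothing with pA m in p
      ... | just v with sB v
      ... | nothing with refl ← eq = inE m v p

    switched : Matching G
    switched = record
      { pA = newA ; pB = newB ; pA⇒pB = newA⇒newB ; pB⇒pA = newB⇒newA ; inE = newA-inE }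

    gainA : Fin nA → ℤ
    gainA m = maybe (λ w → sign (labA m w)) 0ℤ (sA m)

    gainB : Fin nB → ℤ
    gainB w = maybe (λ m → sign (labB m w)) 0ℤ (sB w)

    lossA : Fin nA → ℤ
    lossA m = - indicator (is-nothing (newA m) ∧ is-just (pA m))

    lossB : Fin nB → ℤ
    lossB w = - indicator (is-nothing (newB w) ∧ is-just (pB w))

    gain loss : ℤ
    gain = sum gainA + sum gainB
    loss = sum lossA + sum lossB

    private
      prefA-switch : ∀ m → indicator (prefA G m (newA m) (pA m))
                         ≡ indicator (prefA G m (pA m) (newA m)) + (gainA m + lossA m)
      prefA-switch m with sA m in s
      ... | just w = trans (prefA-flip m w (pA m) (proj₁ (nonMatching m w s)) (inE m) (proj₂ (nonMatching m w s)))
                           (cong (λ g → indicator (prefA G m (pA m) (just w)) + g) (sym (ℤ.+-identityʳ _)))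
      ... | nothing with pA m
      ... | nothing = refl
      ... | just v with sB v
      ... | just _  = refl
      ... | nothing = sym (ℤ.+-identityʳ _)

      prefB-switch : ∀ w → indicator (prefB G w (newB w) (pB w))
                         ≡ indicator (prefB G w (pB w) (newB w)) + (gainB w + lossB w)
      prefB-switch w with sB w in s
      ... | just m = trans (prefB-flip w m (pB w) (proj₁ m-w) (λ u p → inE u w (pB⇒pA u w p))
                                      (proj₂ m-w ∘ pB⇒pA m w))
                           (cong (λ g → indicator (prefB G w (pB w) (just m)) + g) (sym (ℤ.+-identityʳ _)))
        where
        m-w : NonMatchingEdge m w
        m-w = nonMatching m w (sB⇒sA m w s)
      ... | nothing with pB w
      ... | nothing = refl
      ... | just u with sA u
      ... | just _  = refl
      ... | nothing = sym (ℤ.+-identityʳ _)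

      ∑-distrib-+₃ : ∀ {n} (f g h : Fin n → ℤ) → sum (λ i → f i + (g i + h i)) ≡ sum f + (sum g + sum h)
      ∑-distrib-+₃ f g h = trans (∑-distrib-+ f _) (cong (λ s → sum f + s) (∑-distrib-+ g h))

      regroup : ∀ a b c d e f → (a + (b + c)) + (d + (e + f)) ≡ (a + d) + ((b + e) + (c + f))
      regroup = solve-∀

    φ-switch : + φ G switched M ≡ + φ G M switched + (gain + loss)
    φ-switch = begin
      + φ G switched M
        ≡⟨ φ-as-sum switched M ⟩
      sum (λ m → indicator (prefA G m (newA m) (pA m))) + sum (λ w → indicator (prefB G w (newB w) (pB w)))
        ≡⟨ cong₂ _+_ (sum-cong-≗ prefA-switch) (sum-cong-≗ prefB-switch) ⟩
      sum (λ m → oldA m + (gainA m + lossA m)) + sum (λ w → oldB w + (gainB w + lossB w))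
        ≡⟨ cong₂ _+_ (∑-distrib-+₃ oldA gainA lossA) (∑-distrib-+₃ oldB gainB lossB) ⟩
      (sum oldA + (sum gainA + sum lossA)) + (sum oldB + (sum gainB + sum lossB))
        ≡⟨ regroup (sum oldA) (sum gainA) (sum lossA) (sum oldB) (sum gainB) (sum lossB) ⟩
      (sum oldA + sum oldB) + (gain + loss)
        ≡⟨ cong (_+ (gain + loss)) (φ-as-sum M switched) ⟨
      + φ G M switched + (gain + loss) ∎
      where
      open ≡-Reasoning
      oldA : Fin nA → ℤ
      oldA m = indicator (prefA G m (pA m) (newA m))
      oldB : Fin nB → ℤ
      oldB w = indicator (prefB G w (pB w) (newB w))

    lossA-values : ∀ m → lossA m ≡ 0ℤ ⊎ lossA m ≡ -1ℤ
    lossA-values m = neg-indicator-values _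

    lossB-values : ∀ w → lossB w ≡ 0ℤ ⊎ lossB w ≡ -1ℤ
    lossB-values w = neg-indicator-values _

    lossA≡-1 : ∀ m → lossA m ≡ -1ℤ → sA m ≡ nothing × ∃₂ λ w z → pA m ≡ just w × sB w ≡ just z
    lossA≡-1 m loss with sA m | pA m
    ... | nothing | just w with sB w in c
    ... | just z = refl , w , z , refl , c

    lossB≡-1 : ∀ w → lossB w ≡ -1ℤ → sB w ≡ nothing × ∃₂ λ m v → pB w ≡ just m × sA m ≡ just v
    lossB≡-1 w loss with sB w | pB w
    ... | nothing | just m with sA m in c
    ... | just v = refl , m , v , refl , c

    switched-feasible : Feasible G M → (∀ m → C m ≡ true → lossA m ≡ 0ℤ) → Feasible G switched
    switched-feasible feasible kept m cm with newA m in n | feasible m cm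
    ... | just w  | _     = w , refl
    ... | nothing | v , p with () ← trans (sym (cong₂ (λ a b → - indicator (is-nothing a ∧ is-just b)) n p)) (kept m cm)

    popular⇒gain+loss≤0 : PopularFeasible G M → (∀ m → C m ≡ true → lossA m ≡ 0ℤ) → gain + loss ≤ 0ℤ
    popular⇒gain+loss≤0 (feasible , popular) kept = begin
      gain + loss                                           ≡⟨ cancel (+ φ G M switched) (gain + loss) ⟨
      (+ φ G M switched + (gain + loss)) - + φ G M switched ≡⟨ cong (_- + φ G M switched) φ-switch ⟨
      + φ G switched M - + φ G M switched                   ≤⟨ ℤ.i≤j⇒i-j≤0 (ℤ.+≤+ no-majority) ⟩
      0ℤ                                                    ∎
      where
      open ℤ.≤-Reasoning
      cancel : ∀ a d → (a + d) - a ≡ d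
      cancel = solve-∀
      no-majority : φ G switched M ℕ.≤ φ G M switched
      no-majority = popular switched (switched-feasible feasible kept)

module AlternatingWalks (G : Instance) (M : Matching G) where
  open Instance G
  open Leveling G M
  open Matching M
  open Exchanges G M

  pA-injective : ∀ {m m′ w} → pA m ≡ just w → pA m′ ≡ just w → m ≡ m′
  pA-injective {m} {m′} {w} p p′ = just-injective (trans (sym (pA⇒pB m w p)) (pA⇒pB m′ w p′))

  pB-injective : ∀ {w w′ m} → pB w ≡ just m → pB w′ ≡ just m → w ≡ w′
  pB-injective {w} {w′} {m} p p′ = just-injective (trans (sym (pB⇒pA m w p)) (pB⇒pA m w′ p′))

  edgeWeight : Fin nA → Fin nB → ℤ
  edgeWeight m w = sign (labA m w) + sign (labB m w)

  -- x, M(x), z, M(z), … , y with the edges (z, M(x)), … not in M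
  data Walk : Fin nA → Fin nA → Set where
    []   : ∀ {x} → Walk x x
    step : ∀ {x w z y} → pA x ≡ just w → NonMatchingEdge z w → Walk z y → Walk x y

  private variable
    x y z m : Fin nA

  leavers joiners men : Walk x y → List (Fin nA)
  leavers []               = []
  leavers (step {x} _ _ P) = x ∷ leavers P
  joiners []                   = []
  joiners (step {z = z} _ _ P) = z ∷ joiners P
  men {x} P = x ∷ joiners P

  weight : Walk x y → ℤ
  weight []                       = 0ℤ
  weight (step {w = w} {z} _ _ P) = edgeWeight z w + weight P

  Simple : Walk x y → Set
  Simple []               = ⊤
  Simple (step {x} _ _ P) = x ∉ men P × Simple P

  Switchable : Walk x y → Set
  Switchable []                       = ⊤
  Switchable (step {x} {z = z} _ _ P) = x ∉ leavers P × z ∉ joiners P × Switchable P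

  _++_ : Walk x y → Walk y z → Walk x z
  []         ++ Q = Q
  step p e P ++ Q = step p e (P ++ Q)

  weight-++ : (P : Walk x y) (Q : Walk y z) → weight (P ++ Q) ≡ weight P + weight Q
  weight-++ []                       Q = sym (ℤ.+-identityˡ (weight Q))
  weight-++ (step {w = w} {z} _ _ P) Q =
    trans (cong (λ s → edgeWeight z w + s) (weight-++ P Q)) (sym (ℤ.+-assoc (edgeWeight z w) _ _))

  last∈men : (P : Walk x y) → y ∈ men P
  last∈men []           = here refl
  last∈men (step _ _ P) = there (last∈men P)

  leavers⊆men : (P : Walk x y) → m ∈ leavers P → m ∈ men P
  leavers⊆men (step _ _ P) (here refl) = here refl
  leavers⊆men (step _ _ P) (there i)   = there (leavers⊆men P i)

  men⊆leavers∪last : (P : Walk x y) → m ∈ men P → m ∈ leavers P ⊎ m ≡ y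
  men⊆leavers∪last []           (here refl) = inj₂ refl
  men⊆leavers∪last (step _ _ P) (here refl) = inj₁ (here refl)
  men⊆leavers∪last (step _ _ P) (there i)   with men⊆leavers∪last P i
  ... | inj₁ i′ = inj₁ (there i′)
  ... | inj₂ eq = inj₂ eq

  men-++ˡ : (P : Walk x y) (Q : Walk y z) → m ∈ men P → m ∈ men (P ++ Q)
  men-++ˡ []           Q (here refl) = here refl
  men-++ˡ (step _ _ P) Q (here refl) = here refl
  men-++ˡ (step _ _ P) Q (there i)   = there (men-++ˡ P Q i)

  simple-++ : (P : Walk x y) (Q : Walk y z) → Simple (P ++ Q) → Simple P × Simple Q
  simple-++ []           Q simple             = tt , simple
  simple-++ (step _ _ P) Q (x∉PQ , simplePQ) =
    (x∉PQ ∘ men-++ˡ P Q , proj₁ (simple-++ P Q simplePQ)) , proj₂ (simple-++ P Q simplePQ)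

  split : (P : Walk x z) → y ∈ men P → Σ (Walk x y) λ pre → Σ (Walk y z) λ suf → P ≡ pre ++ suf
  split P            (here refl) = [] , P , refl
  split (step p e P) (there i)   with split P i
  ... | pre , suf , refl = step p e pre , suf , refl

  start∉joiners : (P : Walk x y) → Simple P → x ∉ joiners P
  start∉joiners (step _ _ P) (x∉P , _) = x∉P

  last∉leavers : (P : Walk x y) → Simple P → y ∉ leavers P
  last∉leavers (step _ _ P) (x∉P , _)      (here refl) = x∉P (last∈men P)
  last∉leavers (step _ _ P) (_   , simple) (there i)   = last∉leavers P simple i

  simple⇒switchable : (P : Walk x y) → Simple P → Switchable P
  simple⇒switchable []           _              = tt
  simple⇒switchable (step _ _ P) (x∉P , simple) =
    x∉P ∘ leavers⊆men P , start∉joiners P simple , simple⇒switchable P simple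

  sA-walk : Walk x y → Fin nA → Maybe (Fin nB)
  sA-walk []                       _ = nothing
  sA-walk (step {w = w} {z} _ _ P) m = if does (m ≟ z) then just w else sA-walk P m

  sB-walk : Walk x y → Fin nB → Maybe (Fin nA)
  sB-walk []                       _ = nothing
  sB-walk (step {w = w} {z} _ _ P) v = if does (v ≟ w) then just z else sB-walk P v

  private variable
    v w : Fin nB

  sA-walk-nonMatching : (P : Walk x y) → sA-walk P m ≡ just w → NonMatchingEdge m w
  sA-walk-nonMatching {m = m} (step {z = z} _ e P) s with m ≟ z
  ... | yes refl with refl ← s = e
  ... | no _     = sA-walk-nonMatching P s

  sA-walk-joiner : (P : Walk x y) → sA-walk P m ≡ just w → m ∈ joiners P
  sA-walk-joiner {m = m} (step {z = z} _ _ P) s with m ≟ z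
  ... | yes refl = here refl
  ... | no _     = there (sA-walk-joiner P s)

  joiner-sA-walk : (P : Walk x y) → m ∈ joiners P → sA-walk P m ≢ nothing
  joiner-sA-walk {m = m} (step {z = z} _ _ P) i with m ≟ z | i
  ... | yes refl | _         = λ ()
  ... | no m≢z   | here m≡z  = ⊥-elim (m≢z m≡z)
  ... | no _     | there i′  = joiner-sA-walk P i′

  sB-walk-leaver : (P : Walk x y) → sB-walk P v ≡ just z → ∃[ m ] (m ∈ leavers P × pA m ≡ just v)
  sB-walk-leaver {v = v} (step {x} {w} p _ P) s with v ≟ w
  ... | yes refl = x , here refl , p
  ... | no _ with sB-walk-leaver P s
  ... | m , i , pm = m , there i , pm

  leaver-sB-walk : (P : Walk x y) → m ∈ leavers P → pA m ≡ just v → sB-walk P v ≢ nothing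
  leaver-sB-walk {v = v} (step {w = w} p _ P) i pm with v ≟ w | i
  ... | yes refl | _          = λ ()
  ... | no v≢w   | here refl  = ⊥-elim (v≢w (just-injective (trans (sym pm) p)))
  ... | no _     | there i′   = leaver-sB-walk P i′ pm

  sA⇒sB-walk : (P : Walk x y) → Switchable P → sA-walk P m ≡ just w → sB-walk P w ≡ just m
  sA⇒sB-walk {m = m} {w = w} (step {w = w′} {z} p _ P) (x∉P , _ , switchable) s with m ≟ z
  ... | yes refl with refl ← s rewrite dec-true (w ≟ w) refl = refl
  sA⇒sB-walk {m = m} {w = w} (step {w = w′} {z} p _ P) (x∉P , _ , switchable) s | no _ with w ≟ w′
  ... | no _     = sA⇒sB-walk P switchable s
  ... | yes refl with sB-walk-leaver P (sA⇒sB-walk P switchable s)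
  ...   | m′ , i , pm′ = ⊥-elim (x∉P (subst (_∈ leavers P) (pA-injective pm′ p) i))

  sB⇒sA-walk : (P : Walk x y) → Switchable P → sB-walk P w ≡ just m → sA-walk P m ≡ just w
  sB⇒sA-walk {w = w} {m = m} (step {w = w′} {z} _ _ P) (_ , z∉P , switchable) s with w ≟ w′
  ... | yes refl with refl ← s rewrite dec-true (m ≟ m) refl = refl
  sB⇒sA-walk {w = w} {m = m} (step {w = w′} {z} _ _ P) (_ , z∉P , switchable) s | no _ with m ≟ z
  ... | no _     = sB⇒sA-walk P switchable s
  ... | yes refl = ⊥-elim (z∉P (sA-walk-joiner P (sB⇒sA-walk P switchable s)))

  exchange : (P : Walk x y) → Switchable P → Exchange
  exchange P switchable = record
    { sA = sA-walk P ; sB = sB-walk P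
    ; sA⇒sB = λ _ _ → sA⇒sB-walk P switchable ; sB⇒sA = λ _ _ → sB⇒sA-walk P switchable
    ; nonMatching = λ _ _ → sA-walk-nonMatching P }

  nonjoiner-sA-walk : (P : Walk x y) → m ∉ joiners P → sA-walk P m ≡ nothing
  nonjoiner-sA-walk {m = m} P m∉P with sA-walk P m in s
  ... | nothing = refl
  ... | just _  = ⊥-elim (m∉P (sA-walk-joiner P s))

  gain-exchange : (P : Walk x y) (switchable : Switchable P) → gain (exchange P switchable) ≡ weight P
  gain-exchange [] _ = cong₂ _+_ (sum-zero {nA} _ (λ _ → refl)) (sum-zero {nB} _ (λ _ → refl))
  gain-exchange (step {x} {w} {z} p e P) sw@(x∉P , z∉P , switchable) = begin
    sum (gainA S) + sum (gainB S)
      ≡⟨ cong₂ _+_ (sum-insert z _ (gainA SP) (gainA S) gainA-z pointwiseA)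
                   (sum-insert w _ (gainB SP) (gainB S) gainB-w pointwiseB) ⟩
    (sign (labA z w) + sum (gainA SP)) + (sign (labB z w) + sum (gainB SP))
      ≡⟨ regroup (sign (labA z w)) (sum (gainA SP)) (sign (labB z w)) (sum (gainB SP)) ⟩
    edgeWeight z w + gain SP
      ≡⟨ cong (λ g → edgeWeight z w + g) (gain-exchange P switchable) ⟩
    edgeWeight z w + weight P ∎
    where
    open ≡-Reasoning
    S SP : Exchange
    S  = exchange (step p e P) sw
    SP = exchange P switchable
    regroup : ∀ a b c d → (a + b) + (c + d) ≡ (a + c) + (b + d)
    regroup = solve-∀
    gainA-z : gainA SP z ≡ 0ℤ
    gainA-z rewrite nonjoiner-sA-walk P z∉P = refl
    gainB-w : gainB SP w ≡ 0ℤ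
    gainB-w with sB-walk P w in s
    ... | nothing = refl
    ... | just _ with sB-walk-leaver P s
    ... | m , i , pm = ⊥-elim (x∉P (subst (_∈ leavers P) (pA-injective pm p) i))
    pointwiseA : ∀ m → gainA S m ≡ (if does (m ≟ z) then sign (labA z w) else gainA SP m)
    pointwiseA m with m ≟ z
    ... | yes refl = refl
    ... | no _     = refl
    pointwiseB : ∀ v → gainB S v ≡ (if does (v ≟ w) then sign (labB z w) else gainB SP v)
    pointwiseB v with v ≟ w
    ... | yes refl = refl
    ... | no _     = refl

  displaced-man : (P : Walk x y) (switchable : Switchable P) →
                  lossA (exchange P switchable) m ≡ -1ℤ → m ∈ leavers P × m ∉ joiners P
  displaced-man {m = m} P switchable loss with lossA≡-1 (exchange P switchable) m loss
  ... | s , w , _ , p , c with sB-walk-leaver P c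
  ... | m′ , i , pm′ = subst (_∈ leavers P) (pA-injective pm′ p) i , λ j → joiner-sA-walk P j s

  displaced-woman : (P : Walk x y) (switchable : Switchable P) →
                    lossB (exchange P switchable) v ≡ -1ℤ → ∃[ m ] (pB v ≡ just m × m ∈ joiners P × m ∉ leavers P)
  displaced-woman {v = v} P switchable loss with lossB≡-1 (exchange P switchable) v loss
  ... | s , m , _ , pb , c = m , pb , sA-walk-joiner P c , λ i → leaver-sB-walk P i (pB⇒pA m v pb) s

  -- Switching along an alternating cycle leaves nobody unmatched.
  closed-walk-weight≤0 : PopularFeasible G M → (P : Walk z y) → Simple P →
                         (p : pA y ≡ just w) (e : NonMatchingEdge z w) → weight (step p e P) ≤ 0ℤ
  closed-walk-weight≤0 popular P simple p e = begin
    weight Q                        ≡⟨ ℤ.+-identityʳ (weight Q) ⟨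
    weight Q + 0ℤ                   ≡⟨ cong₂ _+_ (gain-exchange Q switchable) no-loss ⟨
    gain S + loss S                 ≤⟨ popular⇒gain+loss≤0 S popular (λ m _ → no-lossA m) ⟩
    0ℤ                              ∎
    where
    open ℤ.≤-Reasoning
    Q = step p e P
    switchable : Switchable Q
    switchable = last∉leavers P simple , start∉joiners P simple , simple⇒switchable P simple
    S = exchange Q switchable
    leavers⊆joiners : m ∈ leavers Q → m ∈ joiners Q
    leavers⊆joiners (here refl) = last∈men P
    leavers⊆joiners (there i)   = leavers⊆men P i
    joiners⊆leavers : m ∈ joiners Q → m ∈ leavers Q
    joiners⊆leavers i with men⊆leavers∪last P i
    ... | inj₁ i′   = there i′
    ... | inj₂ refl = here refl
    no-lossA : ∀ m → lossA S m ≡ 0ℤ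
    no-lossA m with lossA-values S m
    ... | inj₁ l = l
    ... | inj₂ l with displaced-man Q switchable l
    ... | i , j∉ = ⊥-elim (j∉ (leavers⊆joiners i))
    no-lossB : ∀ v → lossB S v ≡ 0ℤ
    no-lossB v with lossB-values S v
    ... | inj₁ l = l
    ... | inj₂ l with displaced-woman Q switchable l
    ... | _ , _ , j , i∉ = ⊥-elim (i∉ (joiners⊆leavers j))
    no-loss : loss S ≡ 0ℤ
    no-loss = cong₂ _+_ (sum-zero _ no-lossA) (sum-zero _ no-lossB)

  -- Only the start man and the partner of the last man can lose their partner.
  simple-weight≤2 : PopularFeasible G M → (P : Walk x y) → Simple P → C x ≡ false → weight P ≤ + 2
  simple-weight≤2 {x} {y} popular P simple cx = begin
    weight P                          ≡⟨ shift (weight P) ⟩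
    (weight P + -[1+ 1 ]) + + 2       ≤⟨ ℤ.+-monoˡ-≤ (+ 2) (ℤ.+-monoʳ-≤ (weight P) loss≥-2) ⟩
    (weight P + loss S) + + 2         ≤⟨ ℤ.+-monoˡ-≤ (+ 2) gain+loss≤0 ⟩
    0ℤ + + 2                          ≡⟨⟩
    + 2                               ∎
    where
    open ℤ.≤-Reasoning
    shift : ∀ a → a ≡ (a + -[1+ 1 ]) + + 2
    shift = solve-∀
    switchable = simple⇒switchable P simple
    S = exchange P switchable
    displaced-start : lossA S m ≡ -1ℤ → m ≡ x
    displaced-start l with displaced-man P switchable l
    ... | i , j∉ with leavers⊆men P i
    ... | here m≡x = m≡x
    ... | there j  = ⊥-elim (j∉ j)
    displaced-last : lossB S v ≡ -1ℤ → pB v ≡ just y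
    displaced-last l with displaced-woman P switchable l
    ... | _ , pb , j , i∉ with men⊆leavers∪last P (there j)
    ... | inj₁ i    = ⊥-elim (i∉ i)
    ... | inj₂ refl = pb
    kept : ∀ m → C m ≡ true → lossA S m ≡ 0ℤ
    kept m cm with lossA-values S m
    ... | inj₁ l = l
    ... | inj₂ l with refl ← displaced-start l with () ← trans (sym cm) cx
    loss≥-2 : -[1+ 1 ] ≤ loss S
    loss≥-2 = ℤ.+-mono-≤
      (sum-≥-1 _ (lossA-values S) (λ _ _ l l′ → trans (displaced-start l) (sym (displaced-start l′))))
      (sum-≥-1 _ (lossB-values S) (λ _ _ l l′ → pB-injective (displaced-last l) (displaced-last l′)))
    gain+loss≤0 : weight P + loss S ≤ 0ℤ
    gain+loss≤0 = subst (λ g → g + loss S ≤ 0ℤ) (gain-exchange P switchable) (popular⇒gain+loss≤0 S popular kept)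

level-up : ∀ a b ℓ → a ≡ true → b ≡ true → + (suc ℓ ℕ.+ suc ℓ) ≤ (sign a + sign b) + + (ℓ ℕ.+ ℓ)
level-up .true .true ℓ refl refl = ℤ.+≤+ (ℕ.≤-reflexive (cong suc (ℕ.+-suc ℓ ℓ)))

level-keep : ∀ a b ℓ → (a xor b) ≡ true → + (ℓ ℕ.+ ℓ) ≤ (sign a + sign b) + + (ℓ ℕ.+ ℓ)
level-keep true  false ℓ _ = ℤ.≤-refl
level-keep false true  ℓ _ = ℤ.≤-refl

level-down : ∀ a b ℓ → a ≡ false → b ≡ false → 2 ℕ.≤ ℓ →
             + ((ℓ ∸ 1) ℕ.+ (ℓ ∸ 1)) ≤ (sign a + sign b) + + (ℓ ℕ.+ ℓ)
level-down .false .false 1             refl refl (s≤s ())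
level-down .false .false (suc (suc t)) refl refl _ = ℤ.+≤+ (ℕ.≤-reflexive (sym (ℕ.+-suc t (suc t))))

n+n≤2⇒n≡0∨n≡1 : ∀ ℓ → ℓ ℕ.+ ℓ ℕ.≤ 2 → ℓ ≡ 0 ⊎ ℓ ≡ 1
n+n≤2⇒n≡0∨n≡1 0             _ = inj₁ refl
n+n≤2⇒n≡0∨n≡1 1             _ = inj₂ refl
n+n≤2⇒n≡0∨n≡1 (suc (suc t)) (s≤s (s≤s t+2+t≤0)) with () ← ℕ.≤-trans (ℕ.m≤n+m (suc (suc t)) t) t+2+t≤0

module LevelInvariant (G : Instance) (M : Matching G) (popular : PopularFeasible G M) where
  open Instance G
  open Leveling G M
  open Matching M
  open AlternatingWalks G M
  open DecMembership {A = Fin nA} _≟_ using (_∈?_)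

  -- A (+1, +1) edge raises the level by one and has weight 2.
  Witnessed : Levels → Set
  Witnessed L = ∀ m → ∃[ y ] Σ (Walk m y) λ P → Simple P × + (proj₁ L m ℕ.+ proj₁ L m) ≤ weight P

  shortcut : ∀ {m w z y} → pA m ≡ just w → (e : NonMatchingEdge z w) → (pre : Walk z m) (suf : Walk m y) →
             Simple (pre ++ suf) → edgeWeight z w + weight (pre ++ suf) ≤ weight suf
  shortcut {w = w} {z} p e pre suf simple = begin
    edgeWeight z w + weight (pre ++ suf)       ≡⟨ cong (λ s → edgeWeight z w + s) (weight-++ pre suf) ⟩
    edgeWeight z w + (weight pre + weight suf) ≡⟨ ℤ.+-assoc (edgeWeight z w) _ _ ⟨
    weight (step p e pre) + weight suf         ≤⟨ ℤ.+-monoˡ-≤ (weight suf) cycle≤0 ⟩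
    0ℤ + weight suf                            ≡⟨ ℤ.+-identityˡ (weight suf) ⟩
    weight suf                                 ∎
    where
    open ℤ.≤-Reasoning
    cycle≤0 = closed-walk-weight≤0 popular pre (proj₁ (simple-++ pre suf simple)) p e

  extend : ∀ {m w z y} → pA m ≡ just w → (e : NonMatchingEdge z w) → (P : Walk z y) → Simple P →
           ∃[ y′ ] Σ (Walk m y′) λ Q → Simple Q × edgeWeight z w + weight P ≤ weight Q
  extend {m} {w} {z} p e P simple with m ∈? men P
  ... | no m∉P = _ , step p e P , (m∉P , simple) , ℤ.≤-refl
  ... | yes m∈P with split P m∈P
  ... | pre , suf , P≡pre++suf = _ , suf , proj₂ (simple-++ pre suf simple′) ,
    subst (λ P → edgeWeight z w + weight P ≤ weight suf) (sym P≡pre++suf) (shortcut p e pre suf simple′)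
    where
    simple′ = subst Simple P≡pre++suf simple

  setW-men : ∀ L w k m → proj₁ (setW L w k) m ≡ proj₁ L m ⊎ (pB w ≡ just m × proj₁ (setW L w k) m ≡ k)
  setW-men (la , lb) w k m with pB w
  ... | nothing = inj₁ refl
  ... | just m′ with m ≟ m′
  ...   | yes refl = inj₂ (refl , refl)
  ...   | no _     = inj₁ refl

  witnessed-setW : ∀ L {m₀ w} k → Witnessed L → NonMatchingEdge m₀ w →
                   + (k ℕ.+ k) ≤ edgeWeight m₀ w + + (proj₁ L m₀ ℕ.+ proj₁ L m₀) → Witnessed (setW L w k)
  witnessed-setW L {m₀} {w} k witnessed e k≤ m with setW-men L w k m
  ... | inj₁ unchanged rewrite unchanged = witnessed m
  ... | inj₂ (pb , set) rewrite set with witnessed m₀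
  ... | _ , P , simple , ℓ≤P with extend (pB⇒pA m w pb) e P simple
  ... | _ , Q , simpleQ , P≤Q =
    _ , Q , simpleQ , ℤ.≤-trans k≤ (ℤ.≤-trans (ℤ.+-monoʳ-≤ (edgeWeight m₀ w) ℓ≤P) P≤Q)

  witnessed-step1 : ∀ {L L′} → Step1 L L′ → Witnessed L → Witnessed L′
  witnessed-step1 (step1 L m w (e , a , b , _)) witnessed =
    witnessed-setW L _ witnessed e (level-up _ _ (proj₁ L m) a b)

  witnessed-step2 : ∀ {L L′} → Step2 L L′ → Witnessed L → Witnessed L′
  witnessed-step2 (step2 L m w (e , a⊕b , _)) witnessed =
    witnessed-setW L _ witnessed e (level-keep (labA m w) (labB m w) (proj₁ L m) a⊕b)

  witnessed-step3 : ∀ {L L′} → Step3 L L′ → Witnessed L → Witnessed L′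
  witnessed-step3 (step3 L m w (e , a , b , w+2≤m)) witnessed =
    witnessed-setW L _ witnessed e (level-down _ _ (proj₁ L m) a b (ℕ.≤-trans (ℕ.m≤n+m 2 (proj₂ L w)) w+2≤m))

  star-witnessed : ∀ {R : Levels → Levels → Set} → (∀ {L L′} → R L L′ → Witnessed L → Witnessed L′) →
                   ∀ {L L′} → Star R L L′ → Witnessed L → Witnessed L′
  star-witnessed preserves = fold (λ L L′ → Witnessed L → Witnessed L′) (λ r rs → rs ∘ preserves r) id

  witnessed-round : ∀ {L L′} → Round L L′ → Witnessed L → Witnessed L′
  witnessed-round (_ , _ , (phase1 , _) , (phase2 , _) , (phase3 , _)) =
    star-witnessed witnessed-step3 phase3 ∘ star-witnessed witnessed-step2 phase2 ∘ star-witnessed witnessed-step1 phase1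

  result-witnessed : ∀ {L} → Result L → Witnessed L
  result-witnessed (history , _) =
    star-witnessed witnessed-round history (λ m → m , [] , tt , ℤ.+≤+ ℕ.z≤n)

mainTheorem7 : (G : Instance) (M : Matching G) → PopularFeasible G M →
               (L : Leveling.Levels G M) → Leveling.Result G M L →
               ∀ m → Instance.C G m ≡ false →
               (proj₁ L m ≡ 0) ⊎ (proj₁ L m ≡ 1)
mainTheorem7 G M popular L result m noncritical with LevelInvariant.result-witnessed G M popular result m
... | _ , P , simple , level≤weight =
  n+n≤2⇒n≡0∨n≡1 (proj₁ L m) (ℤ.drop‿+≤+ (ℤ.≤-trans level≤weight (simple-weight≤2 popular P simple noncritical)))
  where open AlternatingWalks G M
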